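{- Let $\mathcal C=(V,\mathcal I,\mathcal D)$ be a configuration. The following are equivalent: (i) $\mathcal C$ is a right-angled configuration; (ii) all nubs of $\mathcal C$ have cardinality $2$; (iii) for all independence sets $x_1,\dots,x_k\in\mathcal I$ such that $x_i\parallel x_j$ whenever $i\neq j$, the set $x_1\cup\dots\cup x_k$ belongs to $\mathcal I$; (iv) for all vertices $a_1,\dots,a_k\in V$ such that $\{a_i\}\parallel\{a_j\}$ whenever $i\neq j$, the set $\{a_1,\dots,a_k\}$ belongs to $\mathcal I$; (v) for every $x\in\mathcal I$, $\mathcal I^{\parallel x}=\mathcal I\cap\mathcal P(V^{\parallel x})$; (vi) for every vertex $a\in V$, $\mathcal I^{\parallel \{a\}}=\mathcal I\cap\mathcal P(V^{\parallel \{a\}})$. Moreover, if $\mathcal C$ is a right-angled configuration, then for every $x\in\mathcal I$ the relative configuration $\mathcal C^{\parallel x}$ is also right-angled.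
   Context: A configuration is a triple $(V,\mathcal I,\mathcal D)$ where $V$ is a finite set, $\mathcal I\subseteq\mathcal P(V)$ is non empty, downward closed under inclusion and contains every singleton $\{a\}$, $a\in V$, and $\mathcal D=\mathcal P(V)\setminus\mathcal I$. Elements of $\mathcal I$ are independence sets, elements of $\mathcal D$ dependence sets. The nubs are the inclusion-minimal elements of $\mathcal D$. Two independence sets $x,y$ are parallel, written $x\parallel y$, if $x\cap y=\emptyset$ and $x\cup y\in\mathcal I$. For $x\in\mathcal I$, the relative configuration is $\mathcal C^{\parallel x}=(V^{\parallel x},\mathcal I^{\parallel x},\mathcal D^{\parallel x})$ with $V^{\parallel x}=\{a\in V : x\parallel\{a\}\}$, $\mathcal I^{\parallel x}=\{y\in\mathcal I\cap\mathcal P(V^{\parallel x}) : x\parallel y\}$, $\mathcal D^{\parallel x}=\mathcal P(V^{\parallel x})\setminus\mathcal I^{\parallel x}$. A dependence relation on $V$ is a symmetric reflexive binary relation $D\subseteq V\times V$; the configuration induced by $D$ has $\mathcal D=\{x\in\mathcal P(V) : \exists (a,b)\in D,\ a\neq b,\ \{a,b\}\subseteq x\}$ and $\mathcal I=\mathcal P(V)\setminus\mathcal D$. A configuration is right-angled if it is induced in this way by some dependence relation on $V$. -}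

module Defs where

open import Data.Nat using (ℕ)
open import Data.Fin using (Fin)
open import Data.Fin.Subset using (Subset; _∈_; _⊆_; _∪_; _∩_; ⊥; ⁅_⁆; ∣_∣; ⋃)
open import Data.List using (tabulate)
open import Data.Product using (Σ; ∃; _×_; _,_)
open import Data.Unit using (⊤)
open import Relation.Nullary using (¬_; Dec)
open import Relation.Binary.PropositionalEquality using (_≡_; _≢_)
open import Function using (_⇔_; _∘_)

-- Ind is the family of independence sets I; dependence sets are those not in Ind.
-- Membership in I is decidable (as it is classically for a finite family).
record Configuration (n : ℕ) : Set₁ where
  field
    Ind        : Subset n → Set
    Ind?       : (x : Subset n) → Dec (Ind x)
    nonempty   : ∃ λ x → Ind x
    downward   : ∀ {x y} → x ⊆ y → Ind y → Ind x
    singletons : ∀ (a : Fin n) → Ind ⁅ a ⁆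

module _ {n : ℕ} (C : Configuration n) where
  open Configuration C

  Parallel : Subset n → Subset n → Set
  Parallel x y = (x ∩ y ≡ ⊥) × Ind (x ∪ y)

  Nub : Subset n → Set
  Nub x = ¬ Ind x × (∀ y → y ⊆ x → ¬ Ind y → y ≡ x)

  NubsHaveCard2 : Set
  NubsHaveCard2 = ∀ x → Nub x → ∣ x ∣ ≡ 2

  ParallelUnionClosed : Set
  ParallelUnionClosed =
    ∀ (k : ℕ) (xs : Fin k → Subset n) →
    (∀ i → Ind (xs i)) →
    (∀ i j → i ≢ j → Parallel (xs i) (xs j)) →
    Ind (⋃ (tabulate xs))

  ParallelVerticesClosed : Set
  ParallelVerticesClosed =
    ∀ (k : ℕ) (as : Fin k → Fin n) →
    (∀ i j → i ≢ j → Parallel ⁅ as i ⁆ ⁅ as j ⁆) →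
    Ind (⋃ (tabulate (⁅_⁆ ∘ as)))

  RelV : Subset n → Fin n → Set
  RelV x a = Parallel x ⁅ a ⁆

  InRelV : Subset n → Subset n → Set
  InRelV x y = ∀ a → a ∈ y → RelV x a

  RelI : Subset n → Subset n → Set
  RelI x y = (Ind y × InRelV x y) × Parallel x y

  RelEqAll : Set
  RelEqAll = ∀ x → Ind x → ∀ y → (RelI x y ⇔ (Ind y × InRelV x y))

  RelEqVertices : Set
  RelEqVertices = ∀ a → ∀ y → (RelI ⁅ a ⁆ y ⇔ (Ind y × InRelV ⁅ a ⁆ y))

InducedDep : ∀ {n} → (Fin n → Fin n → Set) → Subset n → Set
InducedDep D x = Σ _ λ a → Σ _ λ b → D a b × a ≢ b × a ∈ x × b ∈ x

-- A configuration on the ground set W ⊆ Fin n (given as a predicate) whose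
-- independence family is J (on subsets of W) is right-angled if it is induced by
-- a symmetric reflexive relation D (only its restriction to W matters).
RightAngledOn : ∀ {n} → (Fin n → Set) → (Subset n → Set) → Set₁
RightAngledOn {n} W J =
  Σ (Fin n → Fin n → Set) λ D →
    (∀ a → D a a) × (∀ a b → D a b → D b a) ×
    (∀ y → (∀ a → a ∈ y → W a) → (J y ⇔ (¬ InducedDep D y)))

RightAngled : ∀ {n} → Configuration n → Set₁
RightAngled C = RightAngledOn (λ _ → ⊤) (Configuration.Ind C)

-- Regard I as a simplicial complex on V. C is right-angled exactly when I is
-- flag (a set all of whose pairs are independent is independent), D relating
-- two vertices when they are equal or form a dependent pair. Every other
-- condition is equivalent to flagness: a nub of a flag complex is a dependent
-- pair, and every dependent set contains a nub; unions of pairwise parallel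
-- independent sets, and x ∪ y for independent y ⊆ V^{∥x}, have only independent
-- pairs; conversely (iv) applied to an enumeration of a pairwise independent
-- set, or (vi) applied one vertex at a time, shows that it is independent.
-- For right-angled C, I^{∥x} is I restricted to V^{∥x}, so C^{∥x} is induced
-- by the same relation.
module Submission where

open import Defs
open import Data.Nat using (ℕ; zero; suc)
open import Data.Nat.Properties using (suc-injective)
open import Data.Fin using (Fin; zero; suc; _≟_)
open import Data.Fin.Properties using (any?)
open import Data.Fin.Subset
  using (Subset; _∈_; _∉_; _⊆_; _∪_; _∩_; _─_; _-_; ⁅_⁆; ∣_∣; ⋃; Empty; inside; outside)
  renaming (⊥ to ∅)
open import Data.Fin.Subset.Properties
  using ( _∈?_; nonempty?; Empty-unique; drop-there; ∉⊥; ⊥⊆; ⊆-refl; ⊆-antisym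
        ; x∈⁅x⁆; x∈⁅y⁆⇒x≡y; ∣⁅x⁆∣≡1; x∈p∩q⁺; x∈p∩q⁻; x∈p∪q⁺; x∈p∪q⁻; p⊆p∪q; q⊆p∪q
        ; ∪-identityˡ; ∪-identityʳ; p─q⊆p; x∈p∧x≢y⇒x∈p-y; x∈p⇒p-x⊂p )
open import Data.Fin.Subset.Induction using (⊂-wellFounded)
open import Data.List using (tabulate)
open import Data.Vec using (_∷_; here; there)
open import Data.Product using (∃; ∃₂; _×_; _,_; proj₁; proj₂)
open import Data.Sum using (_⊎_; inj₁; inj₂; [_,_])
open import Data.Unit using (tt)
open import Data.Empty using (⊥-elim)
open import Induction.WellFounded using (module All)
open import Relation.Nullary using (¬_; yes; no; ¬?; _×-dec_)
open import Relation.Nullary.Decidable using (decidable-stable)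
open import Relation.Binary.PropositionalEquality using (_≡_; _≢_; refl; sym; trans; cong; subst)
open import Function using (_⇔_; mk⇔; _∘_; Equivalence)
open import Function.Definitions using (Injective)
open import Function.Construct.Composition using (_⇔-∘_)

open Equivalence

private
  variable
    n : ℕ

removal-induction : (P : Subset n → Set) →
  (∀ y → (∀ {a} → a ∈ y → P (y - a)) → P y) → ∀ y → P y
removal-induction P step =
  All.wfRec ⊂-wellFounded _ P λ y rec → step y (λ a∈y → rec (x∈p⇒p-x⊂p a∈y))

x∈p─q⇒x∉q : ∀ (p q : Subset n) {x} → x ∈ p ─ q → x ∉ q
x∈p─q⇒x∉q (_ ∷ p) (inside ∷ q) (there x∈) x∈q = x∈p─q⇒x∉q p q x∈ (drop-there x∈q)
x∈p─q⇒x∉q (_ ∷ p) (outside ∷ q) (there x∈) x∈q = x∈p─q⇒x∉q p q x∈ (drop-there x∈q)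

x∈p-y⇒x≢y : ∀ {p : Subset n} {x y} → x ∈ p - y → x ≢ y
x∈p-y⇒x≢y {p = p} {y = y} x∈ refl = x∈p─q⇒x∉q p ⁅ y ⁆ x∈ (x∈⁅x⁆ y)

p⊆q∧x∉p⇒p⊆q-x : ∀ {p q : Subset n} {x} → p ⊆ q → x ∉ p → p ⊆ q - x
p⊆q∧x∉p⇒p⊆q-x p⊆q x∉p y∈p = x∈p∧x≢y⇒x∈p-y (p⊆q y∈p) λ { refl → x∉p y∈p }

disjoint⁺ : ∀ {p q : Subset n} → (∀ {x} → x ∈ p → x ∉ q) → p ∩ q ≡ ∅
disjoint⁺ {p = p} {q} f = Empty-unique λ (x , x∈p∩q) →
  f (proj₁ (x∈p∩q⁻ p q x∈p∩q)) (proj₂ (x∈p∩q⁻ p q x∈p∩q))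

disjoint⁻ : ∀ {p q : Subset n} {x} → p ∩ q ≡ ∅ → x ∈ p → x ∉ q
disjoint⁻ {x = x} p∩q≡∅ x∈p x∈q = ∉⊥ (subst (x ∈_) p∩q≡∅ (x∈p∩q⁺ (x∈p , x∈q)))

x∈⋃⁻ : ∀ k (xs : Fin k → Subset n) {x} → x ∈ ⋃ (tabulate xs) → ∃ λ i → x ∈ xs i
x∈⋃⁻ zero xs x∈ = ⊥-elim (∉⊥ x∈)
x∈⋃⁻ (suc k) xs x∈ with x∈p∪q⁻ (xs zero) (⋃ (tabulate (xs ∘ suc))) x∈
... | inj₁ x∈x₀ = zero , x∈x₀
... | inj₂ x∈rest with x∈⋃⁻ k (xs ∘ suc) x∈rest
...   | i , x∈xᵢ = suc i , x∈xᵢ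

x∈⋃⁺ : ∀ k (xs : Fin k → Subset n) {x} i → x ∈ xs i → x ∈ ⋃ (tabulate xs)
x∈⋃⁺ (suc k) xs zero x∈ = x∈p∪q⁺ (inj₁ x∈)
x∈⋃⁺ (suc k) xs (suc i) x∈ = x∈p∪q⁺ (inj₂ (x∈⋃⁺ k (xs ∘ suc) i x∈))

pair : Fin n → Fin n → Subset n
pair a b = ⁅ a ⁆ ∪ ⁅ b ⁆

∈pairˡ : ∀ {a b : Fin n} → a ∈ pair a b
∈pairˡ {a = a} = x∈p∪q⁺ (inj₁ (x∈⁅x⁆ a))

∈pairʳ : ∀ {a b : Fin n} → b ∈ pair a b
∈pairʳ {b = b} = x∈p∪q⁺ (inj₂ (x∈⁅x⁆ b))

pair⊆ : ∀ {a b : Fin n} {y} → a ∈ y → b ∈ y → pair a b ⊆ y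
pair⊆ {a = a} {b} {y} a∈y b∈y x∈ with x∈p∪q⁻ ⁅ a ⁆ ⁅ b ⁆ x∈
... | inj₁ x∈⁅a⁆ = subst (_∈ y) (sym (x∈⁅y⁆⇒x≡y a x∈⁅a⁆)) a∈y
... | inj₂ x∈⁅b⁆ = subst (_∈ y) (sym (x∈⁅y⁆⇒x≡y b x∈⁅b⁆)) b∈y

⁅x⁆∩⁅y⁆≡∅ : ∀ {x y : Fin n} → x ≢ y → ⁅ x ⁆ ∩ ⁅ y ⁆ ≡ ∅
⁅x⁆∩⁅y⁆≡∅ {x = x} {y} x≢y =
  disjoint⁺ λ z∈⁅x⁆ z∈⁅y⁆ → x≢y (trans (sym (x∈⁅y⁆⇒x≡y x z∈⁅x⁆)) (x∈⁅y⁆⇒x≡y y z∈⁅y⁆))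

∣pair∣≡2 : ∀ {x y : Fin n} → x ≢ y → ∣ pair x y ∣ ≡ 2
∣pair∣≡2 {x = zero} {zero} x≢y = ⊥-elim (x≢y refl)
∣pair∣≡2 {x = zero} {suc y} _ = cong suc (trans (cong ∣_∣ (∪-identityˡ ⁅ y ⁆)) (∣⁅x⁆∣≡1 y))
∣pair∣≡2 {x = suc x} {zero} _ = cong suc (trans (cong ∣_∣ (∪-identityʳ ⁅ x ⁆)) (∣⁅x⁆∣≡1 x))
∣pair∣≡2 {x = suc x} {suc y} x≢y = ∣pair∣≡2 (x≢y ∘ cong suc)

∣p∣≡0⇒x∉p : ∀ (p : Subset n) {x} → ∣ p ∣ ≡ 0 → x ∉ p
∣p∣≡0⇒x∉p (inside ∷ p) () _
∣p∣≡0⇒x∉p (outside ∷ p) ∣p∣≡0 (there x∈p) = ∣p∣≡0⇒x∉p p ∣p∣≡0 x∈p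

∣p∣≡1⇒p⊆⁅x⁆ : ∀ (p : Subset n) → ∣ p ∣ ≡ 1 → ∃ λ x → x ∈ p × p ⊆ ⁅ x ⁆
∣p∣≡1⇒p⊆⁅x⁆ (inside ∷ p) ∣p∣≡1 = zero , here , λ
  { here → here
  ; (there y∈p) → ⊥-elim (∣p∣≡0⇒x∉p p (suc-injective ∣p∣≡1) y∈p) }
∣p∣≡1⇒p⊆⁅x⁆ (outside ∷ p) ∣p∣≡1 with ∣p∣≡1⇒p⊆⁅x⁆ p ∣p∣≡1
... | x , x∈p , p⊆⁅x⁆ = suc x , there x∈p , λ { (there y∈p) → there (p⊆⁅x⁆ y∈p) }

∣p∣≡2⇒p⊆pair : ∀ (p : Subset n) → ∣ p ∣ ≡ 2 → ∃₂ λ x y → x ∈ p × y ∈ p × p ⊆ pair x y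
∣p∣≡2⇒p⊆pair (inside ∷ p) ∣p∣≡2 with ∣p∣≡1⇒p⊆⁅x⁆ p (suc-injective ∣p∣≡2)
... | y , y∈p , p⊆⁅y⁆ = zero , suc y , here , there y∈p , λ
  { here → here
  ; (there z∈p) → there (q⊆p∪q ∅ ⁅ y ⁆ (p⊆⁅y⁆ z∈p)) }
∣p∣≡2⇒p⊆pair (outside ∷ p) ∣p∣≡2 with ∣p∣≡2⇒p⊆pair p ∣p∣≡2
... | x , y , x∈p , y∈p , p⊆pair =
  suc x , suc y , there x∈p , there y∈p , λ { (there z∈p) → there (p⊆pair z∈p) }

Enumeration : Subset n → Set
Enumeration {n} y = ∃₂ λ k (f : Fin k → Fin n) →
  Injective _≡_ _≡_ f × (∀ i → f i ∈ y) × (∀ {x} → x ∈ y → ∃ λ i → f i ≡ x)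

enumerate : (y : Subset n) → Enumeration y
enumerate = removal-induction Enumeration step
  where
  step : ∀ y → (∀ {a} → a ∈ y → Enumeration (y - a)) → Enumeration y
  step y rec with nonempty? y
  ... | no empty = 0 , (λ ()) , (λ { {()} }) , (λ ()) , λ x∈y → ⊥-elim (empty (_ , x∈y))
  ... | yes (a , a∈y) with rec a∈y
  ...   | k , f , f-injective , f∈ , f-covers = suc k , g , g-injective , g∈ , g-covers
    where
    g : Fin (suc k) → _
    g zero = a
    g (suc i) = f i

    g-injective : Injective _≡_ _≡_ g
    g-injective {zero} {zero} _ = refl
    g-injective {zero} {suc j} a≡fj = ⊥-elim (x∈p-y⇒x≢y (f∈ j) (sym a≡fj))
    g-injective {suc i} {zero} fi≡a = ⊥-elim (x∈p-y⇒x≢y (f∈ i) fi≡a)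
    g-injective {suc i} {suc j} fi≡fj = cong suc (f-injective fi≡fj)

    g∈ : ∀ i → g i ∈ y
    g∈ zero = a∈y
    g∈ (suc i) = p─q⊆p y ⁅ a ⁆ (f∈ i)

    g-covers : ∀ {x} → x ∈ y → ∃ λ i → g i ≡ x
    g-covers {x} x∈y with x ≟ a
    ... | yes refl = zero , refl
    ... | no x≢a with f-covers (x∈p∧x≢y⇒x∈p-y x∈y x≢a)
    ...   | i , fi≡x = suc i , fi≡x

module _ (C : Configuration n) where
  open Configuration C

  PairwiseIndependent : Subset n → Set
  PairwiseIndependent y = ∀ {a b} → a ∈ y → b ∈ y → Ind (pair a b)

  Flag : Set
  Flag = ∀ y → PairwiseIndependent y → Ind y

  Ind⇒PairwiseIndependent : ∀ {y} → Ind y → PairwiseIndependent y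
  Ind⇒PairwiseIndependent ind a∈y b∈y = downward (pair⊆ a∈y b∈y) ind

  Ind-Empty : ∀ {y} → Empty y → Ind y
  Ind-Empty empty = subst Ind (sym (Empty-unique empty)) (downward ⊥⊆ (proj₂ nonempty))

  Ind-pair-refl : ∀ a → Ind (pair a a)
  Ind-pair-refl a = downward (pair⊆ (x∈⁅x⁆ a) (x∈⁅x⁆ a)) (singletons a)

  ⁅⁆∥⁅⁆ : ∀ {a b} → a ≢ b → Ind (pair a b) → Parallel C ⁅ a ⁆ ⁅ b ⁆
  ⁅⁆∥⁅⁆ a≢b ind = ⁅x⁆∩⁅y⁆≡∅ a≢b , ind

  pairwiseIndependent⊎dependentPair : ∀ y →
    PairwiseIndependent y ⊎ ∃₂ λ a b → a ∈ y × b ∈ y × ¬ Ind (pair a b)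
  pairwiseIndependent⊎dependentPair y
    with any? (λ a → any? (λ b → a ∈? y ×-dec b ∈? y ×-dec ¬? (Ind? (pair a b))))
  ... | yes dependentPair = inj₂ dependentPair
  ... | no none = inj₁ λ {a} {b} a∈y b∈y →
    decidable-stable (Ind? (pair a b)) λ dep → none (a , b , a∈y , b∈y , dep)

  dependent⇒∃nub : ∀ y → ¬ Ind y → ∃ λ z → z ⊆ y × Nub C z
  dependent⇒∃nub = removal-induction (λ y → ¬ Ind y → ∃ λ z → z ⊆ y × Nub C z) step
    where
    step : ∀ y → (∀ {a} → a ∈ y → ¬ Ind (y - a) → ∃ λ z → z ⊆ y - a × Nub C z) →
           ¬ Ind y → ∃ λ z → z ⊆ y × Nub C z
    step y rec dep with any? (λ a → a ∈? y ×-dec ¬? (Ind? (y - a)))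
    ... | yes (a , a∈y , dep-y-a) with rec a∈y dep-y-a
    ...   | z , z⊆y-a , nub = z , p─q⊆p y ⁅ a ⁆ ∘ z⊆y-a , nub
    step y rec dep | no none = y , ⊆-refl , dep , minimal
      where
      minimal : ∀ w → w ⊆ y → ¬ Ind w → w ≡ y
      minimal w w⊆y dep-w = ⊆-antisym w⊆y λ {x} x∈y → decidable-stable (x ∈? w) λ x∉w →
        none (x , x∈y , λ ind → dep-w (downward (p⊆q∧x∉p⇒p⊆q-x w⊆y x∉w) ind))

  flag⇒parallel : Flag → ∀ {x y} → Ind x → Ind y → InRelV C x y → Parallel C x y
  flag⇒parallel flag {x} {y} ind-x ind-y y⊆V =
    disjoint⁺ (λ {a} a∈x a∈y → disjoint⁻ (proj₁ (y⊆V a a∈y)) a∈x (x∈⁅x⁆ a)) , flag (x ∪ y) pairs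
    where
    pairs : PairwiseIndependent (x ∪ y)
    pairs {a} {b} a∈ b∈ with x∈p∪q⁻ x y a∈ | x∈p∪q⁻ x y b∈
    ... | inj₁ a∈x | inj₁ b∈x = Ind⇒PairwiseIndependent ind-x a∈x b∈x
    ... | inj₂ a∈y | inj₂ b∈y = Ind⇒PairwiseIndependent ind-y a∈y b∈y
    ... | inj₁ a∈x | inj₂ b∈y =
      Ind⇒PairwiseIndependent (proj₂ (y⊆V b b∈y)) (p⊆p∪q ⁅ b ⁆ a∈x) (q⊆p∪q x ⁅ b ⁆ (x∈⁅x⁆ b))
    ... | inj₂ a∈y | inj₁ b∈x =
      Ind⇒PairwiseIndependent (proj₂ (y⊆V a a∈y)) (q⊆p∪q x ⁅ a ⁆ (x∈⁅x⁆ a)) (p⊆p∪q ⁅ a ⁆ b∈x)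

  rightAngled⇔flag : RightAngled C ⇔ Flag
  rightAngled⇔flag = mk⇔ rightAngled⇒flag flag⇒rightAngled
    where
    rightAngled⇒flag : RightAngled C → Flag
    rightAngled⇒flag (D , _ , _ , induced) y pairs =
      from (induced y (λ _ _ → tt)) λ (a , b , Dab , a≢b , a∈y , b∈y) →
        to (induced (pair a b) (λ _ _ → tt)) (pairs a∈y b∈y) (a , b , Dab , a≢b , ∈pairˡ , ∈pairʳ)

    Dependent : Fin n → Fin n → Set
    Dependent a b = a ≡ b ⊎ ¬ Ind (pair a b)

    Dependent-sym : ∀ a b → Dependent a b → Dependent b a
    Dependent-sym a b = [ inj₁ ∘ sym , (λ dep → inj₂ (dep ∘ downward (pair⊆ ∈pairʳ ∈pairˡ))) ]

    flag⇒rightAngled : Flag → RightAngled C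
    flag⇒rightAngled flag = Dependent , (λ _ → inj₁ refl) , Dependent-sym , λ y _ →
      mk⇔ (λ ind (a , b , Dab , a≢b , a∈y , b∈y) →
             [ a≢b , (λ dep → dep (Ind⇒PairwiseIndependent ind a∈y b∈y)) ] Dab)
          (λ indep → flag y λ {a} {b} a∈y b∈y → pairIndependent indep a b a∈y b∈y)
      where
      pairIndependent : ∀ {y} → ¬ InducedDep Dependent y → ∀ a b → a ∈ y → b ∈ y → Ind (pair a b)
      pairIndependent indep a b a∈y b∈y with a ≟ b
      ... | yes refl = Ind-pair-refl a
      ... | no a≢b = decidable-stable (Ind? (pair a b)) λ dep →
        indep (a , b , inj₂ dep , a≢b , a∈y , b∈y)

  flag⇔nubsHaveCard2 : Flag ⇔ NubsHaveCard2 C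
  flag⇔nubsHaveCard2 = mk⇔ flag⇒nubsHaveCard2 nubsHaveCard2⇒flag
    where
    flag⇒nubsHaveCard2 : Flag → NubsHaveCard2 C
    flag⇒nubsHaveCard2 flag x (dep , minimal) with pairwiseIndependent⊎dependentPair x
    ... | inj₁ pairs = ⊥-elim (dep (flag x pairs))
    ... | inj₂ (a , b , a∈x , b∈x , dep-ab) =
      subst (λ z → ∣ z ∣ ≡ 2) (minimal (pair a b) (pair⊆ a∈x b∈x) dep-ab) (∣pair∣≡2 a≢b)
      where
      a≢b : a ≢ b
      a≢b refl = dep-ab (Ind-pair-refl a)

    nubsHaveCard2⇒flag : NubsHaveCard2 C → Flag
    nubsHaveCard2⇒flag card2 y pairs =
      decidable-stable (Ind? y) λ dep → noDependentNub (dependent⇒∃nub y dep)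
      where
      noDependentNub : ¬ ∃ λ z → z ⊆ y × Nub C z
      noDependentNub (z , z⊆y , nub@(dep-z , _)) with ∣p∣≡2⇒p⊆pair z (card2 z nub)
      ... | a , b , a∈z , b∈z , z⊆pair = dep-z (downward z⊆pair (pairs (z⊆y a∈z) (z⊆y b∈z)))

  flag⇒parallelUnionClosed : Flag → ParallelUnionClosed C
  flag⇒parallelUnionClosed flag k xs ind par = flag (⋃ (tabulate xs)) pairs
    where
    pairs : PairwiseIndependent (⋃ (tabulate xs))
    pairs a∈ b∈ with x∈⋃⁻ k xs a∈ | x∈⋃⁻ k xs b∈
    ... | i , a∈xᵢ | j , b∈xⱼ with i ≟ j
    ...   | yes refl = Ind⇒PairwiseIndependent (ind i) a∈xᵢ b∈xⱼ
    ...   | no i≢j = Ind⇒PairwiseIndependent (proj₂ (par i j i≢j))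
                       (p⊆p∪q (xs j) a∈xᵢ) (q⊆p∪q (xs i) (xs j) b∈xⱼ)

  parallelUnionClosed⇒parallelVerticesClosed : ParallelUnionClosed C → ParallelVerticesClosed C
  parallelUnionClosed⇒parallelVerticesClosed closed k as = closed k (⁅_⁆ ∘ as) (singletons ∘ as)

  parallelVerticesClosed⇒flag : ParallelVerticesClosed C → Flag
  parallelVerticesClosed⇒flag closed y pairs with enumerate y
  ... | k , f , f-injective , f∈y , f-covers = downward y⊆⋃ (closed k f parallel)
    where
    parallel : ∀ i j → i ≢ j → Parallel C ⁅ f i ⁆ ⁅ f j ⁆
    parallel i j i≢j = ⁅⁆∥⁅⁆ (i≢j ∘ f-injective) (pairs (f∈y i) (f∈y j))

    y⊆⋃ : y ⊆ ⋃ (tabulate (⁅_⁆ ∘ f))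
    y⊆⋃ x∈y with f-covers x∈y
    ... | i , refl = x∈⋃⁺ k (⁅_⁆ ∘ f) i (x∈⁅x⁆ (f i))

  flag⇔parallelUnionClosed : Flag ⇔ ParallelUnionClosed C
  flag⇔parallelUnionClosed = mk⇔ flag⇒parallelUnionClosed
    (parallelVerticesClosed⇒flag ∘ parallelUnionClosed⇒parallelVerticesClosed)

  flag⇔parallelVerticesClosed : Flag ⇔ ParallelVerticesClosed C
  flag⇔parallelVerticesClosed = mk⇔
    (parallelUnionClosed⇒parallelVerticesClosed ∘ flag⇒parallelUnionClosed) parallelVerticesClosed⇒flag

  flag⇒relEqAll : Flag → RelEqAll C
  flag⇒relEqAll flag x ind-x y =
    mk⇔ proj₁ λ (ind-y , y⊆V) → (ind-y , y⊆V) , flag⇒parallel flag ind-x ind-y y⊆V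

  relEqAll⇒relEqVertices : RelEqAll C → RelEqVertices C
  relEqAll⇒relEqVertices rel a = rel ⁅ a ⁆ (singletons a)

  relEqVertices⇒flag : RelEqVertices C → Flag
  relEqVertices⇒flag rel = removal-induction (λ y → PairwiseIndependent y → Ind y) step
    where
    step : ∀ y → (∀ {a} → a ∈ y → PairwiseIndependent (y - a) → Ind (y - a)) →
           PairwiseIndependent y → Ind y
    step y rec pairs with nonempty? y
    ... | no empty = Ind-Empty empty
    ... | yes (a , a∈y) =
      downward y⊆a∪rest (proj₂ (proj₂ (from (rel a (y - a)) (ind-rest , rest⊆V))))
      where
      rest⊆y : y - a ⊆ y
      rest⊆y = p─q⊆p y ⁅ a ⁆

      ind-rest : Ind (y - a)
      ind-rest = rec a∈y λ b∈ c∈ → pairs (rest⊆y b∈) (rest⊆y c∈)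

      rest⊆V : InRelV C ⁅ a ⁆ (y - a)
      rest⊆V b b∈ = ⁅⁆∥⁅⁆ (x∈p-y⇒x≢y b∈ ∘ sym) (pairs a∈y (rest⊆y b∈))

      y⊆a∪rest : y ⊆ ⁅ a ⁆ ∪ (y - a)
      y⊆a∪rest {b} b∈y with b ≟ a
      ... | yes refl = p⊆p∪q (y - a) (x∈⁅x⁆ a)
      ... | no b≢a = q⊆p∪q ⁅ a ⁆ (y - a) (x∈p∧x≢y⇒x∈p-y b∈y b≢a)

  flag⇔relEqAll : Flag ⇔ RelEqAll C
  flag⇔relEqAll = mk⇔ flag⇒relEqAll (relEqVertices⇒flag ∘ relEqAll⇒relEqVertices)

  flag⇔relEqVertices : Flag ⇔ RelEqVertices C
  flag⇔relEqVertices = mk⇔ (relEqAll⇒relEqVertices ∘ flag⇒relEqAll) relEqVertices⇒flag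

  rightAngled⇒relative-rightAngled : RightAngled C →
    ∀ x → Ind x → RightAngledOn (RelV C x) (RelI C x)
  rightAngled⇒relative-rightAngled ra@(D , D-refl , D-sym , induced) x ind-x =
    D , D-refl , D-sym , λ y y⊆V → mk⇔
      (to (induced y (λ _ _ → tt)) ∘ proj₁ ∘ proj₁)
      (λ indep → from (flag⇒relEqAll flag x ind-x y) (from (induced y (λ _ _ → tt)) indep , y⊆V))
    where
    flag : Flag
    flag = to rightAngled⇔flag ra

proposition3 : ∀ {n : ℕ} (C : Configuration n) →
    (RightAngled C ⇔ NubsHaveCard2 C) ×
    (RightAngled C ⇔ ParallelUnionClosed C) ×
    (RightAngled C ⇔ ParallelVerticesClosed C) ×
    (RightAngled C ⇔ RelEqAll C) ×
    (RightAngled C ⇔ RelEqVertices C) ×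
    (RightAngled C → ∀ (x : Subset n) → Configuration.Ind C x →
    RightAngledOn (RelV C x) (RelI C x))
proposition3 C =
    flag⇔nubsHaveCard2 C ⇔-∘ rightAngled⇔flag C
  , flag⇔parallelUnionClosed C ⇔-∘ rightAngled⇔flag C
  , flag⇔parallelVerticesClosed C ⇔-∘ rightAngled⇔flag C
  , flag⇔relEqAll C ⇔-∘ rightAngled⇔flag C
  , flag⇔relEqVertices C ⇔-∘ rightAngled⇔flag C
  , rightAngled⇒relative-rightAngled C
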